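{- For every positive integer $k$, $w_1(3,k) \leq k\,\Omega(3,k)$.
   Context: $\Omega(3,k)$ is the smallest integer $n$ such that every set $\{x_1, \ldots, x_n\}$ of integers with $x_i \in [(i-1)k+1, ik]$ for each $i$ contains a $3$-term arithmetic progression (with positive common difference). $w_1(3,k)$ is the minimum integer $n$ such that every $2$-coloring (with colors "first" and "second") of $[1,n]$ admits either a $3$-term arithmetic progression all of whose elements have the first color, or $k$ consecutive integers all having the second color. -}

module Defs where

open import Data.Nat using (ℕ; _+_; _*_; _∸_; _≤_; _<_)
open import Data.Bool using (Bool; true; false)
open import Data.Product using (_×_; ∃-syntax)
open import Data.Sum using (_⊎_)
open import Relation.Binary.PropositionalEquality using (_≡_)

IsLeast : (ℕ → Set) → ℕ → Set
IsLeast P n = P n × (∀ m → P m → n ≤ m)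

Admissible : ℕ → ℕ → (ℕ → ℕ) → Set
Admissible k n x = ∀ i → 1 ≤ i → i ≤ n → ((i ∸ 1) * k + 1 ≤ x i) × (x i ≤ i * k)

Has3AP : ℕ → (ℕ → ℕ) → Set
Has3AP n x = ∃[ i ] ∃[ j ] ∃[ l ]
  ((1 ≤ i) × (i ≤ n) × (1 ≤ j) × (j ≤ n) × (1 ≤ l) × (l ≤ n) ×
   (x i < x j) × (x j < x l) × (x j ∸ x i ≡ x l ∸ x j))

OmegaProp : ℕ → ℕ → Set
OmegaProp k n = ∀ (x : ℕ → ℕ) → Admissible k n x → Has3AP n x

IsOmega3 : ℕ → ℕ → Set
IsOmega3 k = IsLeast (OmegaProp k)

-- colouring c of [1,n]: true = "first" colour, false = "second" colour
W1Prop : ℕ → ℕ → Set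
W1Prop k n = ∀ (c : ℕ → Bool) →
  (∃[ a ] ∃[ d ] ((1 ≤ a) × (1 ≤ d) × (a + 2 * d ≤ n) ×
      (c a ≡ true) × (c (a + d) ≡ true) × (c (a + 2 * d) ≡ true)))
  ⊎ (∃[ s ] ((1 ≤ s) × (s + k ∸ 1 ≤ n) ×
      (∀ t → s ≤ t → t < s + k → c t ≡ false)))

IsW1 : ℕ → ℕ → Set
IsW1 k = IsLeast (W1Prop k)

module Submission where

open import Defs
open import Data.Nat using (ℕ; suc; _+_; _*_; _∸_; _≤_; _<_; z≤n; s≤s; _<?_)
open import Data.Nat.Properties
open import Data.Bool using (Bool; true; false)
open import Data.Bool.Properties using (¬-not) renaming (_≟_ to _≟ᵇ_)
open import Data.Product using (_×_; _,_; ∃; ∃-syntax; proj₁; proj₂)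
open import Data.Sum using (_⊎_; inj₁; inj₂)
open import Relation.Nullary using (Dec; yes; no; contradiction)
open import Relation.Binary.PropositionalEquality

-- Cut [1, kΩ] into Ω blocks of k consecutive integers. If some block has only
-- the second colour it is the required run. Otherwise picking a first-coloured
-- element in each block gives an admissible sequence of length Ω, which by the
-- definition of Ω(3,k) contains a 3-term progression, all of first colour.

FalseRun : (ℕ → Bool) → ℕ → ℕ → Set
FalseRun c s n = ∀ {t} → t < n → c (s + t) ≡ false

true-or-falseRun : ∀ c s n → (∃[ t ] t < n × c (s + t) ≡ true) ⊎ FalseRun c s n
true-or-falseRun c s n with anyUpTo? (λ t → c (s + t) ≟ᵇ true) n
... | yes found = inj₁ found
... | no none   = inj₂ λ t<n → ¬-not λ ct → none (_ , t<n , ct)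

falseRun? : ∀ c s n → Dec (FalseRun c s n)
falseRun? c s n with true-or-falseRun c s n
... | inj₁ (_ , t<n , ct) = no λ run → contradiction (trans (sym ct) (run t<n)) λ ()
... | inj₂ run           = yes run

falseRun-interval : ∀ {c s n} → FalseRun c s n → ∀ t → s ≤ t → t < s + n → c t ≡ false
falseRun-interval {c} {s} {n} run t s≤t t<s+n =
  subst (λ u → c u ≡ false) (m+[n∸m]≡n s≤t) (run t∸s<n)
  where
  t∸s<n : t ∸ s < n
  t∸s<n = subst (t ∸ s <_) (m+n∸m≡n s n) (∸-monoˡ-< t<s+n s≤t)

bounded-choice : ∀ {P : ℕ → ℕ → Set} n →
                 (∀ {i} → i < n → ∃ (P i)) → ∃[ f ] (∀ {i} → i < n → P i (f i))
bounded-choice {P} n choose = f , f-spec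
  where
  f : ℕ → ℕ
  f i with i <? n
  ... | yes i<n = proj₁ (choose i<n)
  ... | no _    = 0

  f-spec : ∀ {i} → i < n → P i (f i)
  f-spec {i} i<n with i <? n
  ... | yes i<n′ = proj₂ (choose i<n′)
  ... | no i≮n   = contradiction i<n i≮n

3AP-from-differences : ∀ {a b c} → a < b → b < c → b ∸ a ≡ c ∸ b →
                       (a + (b ∸ a) ≡ b) × (a + 2 * (b ∸ a) ≡ c)
3AP-from-differences {a} {b} {c} a<b b<c same-gap = a+d≡b , a+2d≡c
  where
  open ≡-Reasoning
  d : ℕ
  d = b ∸ a

  a+d≡b : a + d ≡ b
  a+d≡b = m+[n∸m]≡n (<⇒≤ a<b)

  a+2d≡c : a + 2 * d ≡ c
  a+2d≡c = begin
    a + (d + (d + 0)) ≡⟨ cong (λ e → a + (d + e)) (+-identityʳ d) ⟩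
    a + (d + d)       ≡⟨ +-assoc a d d ⟨
    a + d + d         ≡⟨ cong₂ _+_ a+d≡b same-gap ⟩
    b + (c ∸ b)       ≡⟨ m+[n∸m]≡n (<⇒≤ b<c) ⟩
    c                 ∎

-- Blocks are numbered from 0: block b is [b k + 1, (b + 1) k].

block-end : ∀ k b → b * k + 1 + k ∸ 1 ≡ suc b * k
block-end k b = begin
  b * k + 1 + k ∸ 1   ≡⟨ cong (_∸ 1) (+-assoc (b * k) 1 k) ⟩
  b * k + suc k ∸ 1   ≡⟨ +-∸-assoc (b * k) (s≤s z≤n) ⟩
  b * k + k           ≡⟨ +-comm (b * k) k ⟩
  suc b * k           ∎
  where open ≡-Reasoning

block-member : ∀ {k t} b → t < k → b * k + 1 + t ≤ suc b * k
block-member {k} {t} b t<k = begin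
  b * k + 1 + t       ≡⟨ +-assoc (b * k) 1 t ⟩
  b * k + suc t       ≤⟨ +-monoʳ-≤ (b * k) t<k ⟩
  b * k + k           ≡⟨ +-comm (b * k) k ⟩
  suc b * k           ∎
  where open ≤-Reasoning

block-within : ∀ {k b m} → b < m → suc b * k ≤ k * m
block-within {k} {b} {m} b<m = subst (suc b * k ≤_) (*-comm m k) (*-monoˡ-≤ k b<m)

monochromatic-3AP : ∀ {c : ℕ → Bool} {n m} {x : ℕ → ℕ} →
  (∀ {i} → 1 ≤ i → i ≤ m → 1 ≤ x i × x i ≤ n × c (x i) ≡ true) → Has3AP m x →
  ∃[ a ] ∃[ d ] ((1 ≤ a) × (1 ≤ d) × (a + 2 * d ≤ n) ×
    (c a ≡ true) × (c (a + d) ≡ true) × (c (a + 2 * d) ≡ true))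
monochromatic-3AP {c} {n} {x = x} in-range
  (i , j , l , 1≤i , i≤m , 1≤j , j≤m , 1≤l , l≤m , xi<xj , xj<xl , same-gap)
  with in-range 1≤i i≤m | in-range 1≤j j≤m | in-range 1≤l l≤m
     | 3AP-from-differences xi<xj xj<xl same-gap
... | 1≤xi , _ , ci | _ , _ , cj | _ , xl≤n , cl | a+d≡xj , a+2d≡xl =
  x i , x j ∸ x i , 1≤xi , m<n⇒0<n∸m xi<xj ,
  subst (_≤ n) (sym a+2d≡xl) xl≤n ,
  ci , subst (λ y → c y ≡ true) (sym a+d≡xj) cj , subst (λ y → c y ≡ true) (sym a+2d≡xl) cl

w1-bound : ∀ k m → OmegaProp k m → W1Prop k (k * m)
w1-bound k m omega c with anyUpTo? (λ b → falseRun? c (b * k + 1) k) m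
... | yes (b , b<m , run) =
  inj₂ (b * k + 1 , m≤n+m 1 _ ,
        subst (_≤ k * m) (sym (block-end k b)) (block-within b<m) ,
        falseRun-interval run)
... | no no-run = inj₁ (monochromatic-3AP in-range (omega x admissible))
  where
  first-in-block : ∀ {b} → b < m → ∃[ y ] (b * k + 1 ≤ y × y ≤ suc b * k × c y ≡ true)
  first-in-block {b} b<m with true-or-falseRun c (b * k + 1) k
  ... | inj₁ (t , t<k , ct) = b * k + 1 + t , m≤m+n _ t , block-member b t<k , ct
  ... | inj₂ run            = contradiction (b , b<m , λ {t} → run {t}) no-run

  choice : ∃[ f ] (∀ {b} → b < m → b * k + 1 ≤ f b × f b ≤ suc b * k × c (f b) ≡ true)
  choice = bounded-choice m first-in-block

  x : ℕ → ℕ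
  x i = proj₁ choice (i ∸ 1)

  admissible : Admissible k m x
  admissible (suc b) _ b<m with proj₂ choice b<m
  ... | lo , hi , _ = lo , hi

  in-range : ∀ {i} → 1 ≤ i → i ≤ m → 1 ≤ x i × x i ≤ k * m × c (x i) ≡ true
  in-range {suc b} _ b<m with proj₂ choice b<m
  ... | lo , hi , ci = ≤-trans (m≤n+m 1 _) lo , ≤-trans hi (block-within b<m) , ci

lemma10 : ∀ (k Ω w : ℕ) → 1 ≤ k → IsOmega3 k Ω → IsW1 k w → w ≤ k * Ω
lemma10 k Ω w _ (omega , _) (_ , w-least) = w-least (k * Ω) (w1-bound k Ω omega)
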